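{- Let $G$ be a graph and $u\in V(G)$. For an integer $k\geq 1$, let $G_{(u,k)}$ be the graph obtained by gluing $G$ and the complete graph $K_{k+1}$ at the vertex $u$ (i.e. $G_{(u,k)}=K_{k+1}\cup G$ with $K_{k+1}\cap G=\{u\}$). Then for every integer $k\geq 1$, $$D_{G_{(u,k)}}(x)=(x+1)^{k-1}\left[D_{G_{(u,1)}}(x)+D_{G\setminus u}(x)\right]-D_{G\setminus u}(x).$$
   Context: All graphs are finite, simple and undirected. A set $S\subseteq V(G)$ is a dominating set of $G$ if every vertex of $V(G)\setminus S$ is adjacent to some vertex of $S$. The domination polynomial of a graph $G$ is $D_G(x)=\sum_{S}x^{|S|}$, the sum over all dominating sets $S$ of $G$ (for the graph with no vertices, $D(x)=1$). $G\setminus u$ denotes the subgraph induced by $V(G)\setminus\{u\}$. -}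

module Defs where

open import Data.Nat using (ℕ; zero; suc; _+_)
open import Data.Integer as ℤ using (ℤ)
open import Data.Bool using (Bool; true; false; not; _∧_)
open import Data.Fin using (Fin; splitAt; punchIn; _≟_)
open import Data.Fin.Subset using (Subset; _∈_; ∣_∣)
open import Data.Fin.Subset.Properties using (_∈?_)
open import Data.Fin.Properties using (all?; any?)
open import Data.Vec using (Vec; []; _∷_)
open import Data.List using (List; []; _∷_; _++_; map; filter; length)
open import Data.Sum using (_⊎_; inj₁; inj₂)
open import Data.Product using (∃; _×_)
open import Relation.Binary.PropositionalEquality using (_≡_)
open import Relation.Nullary using (Dec; ¬_)
open import Relation.Nullary.Decidable using (⌊_⌋; _⊎-dec_; _×-dec_)
import Data.Bool.Properties as BoolP
import Data.Nat.Properties as ℕP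

Adj : ℕ → Set
Adj n = Fin n → Fin n → Bool

IsSimple : {n : ℕ} → Adj n → Set
IsSimple {n} adj = (∀ (v w : Fin n) → adj v w ≡ adj w v) × (∀ (v : Fin n) → adj v v ≡ false)

Dominating : {n : ℕ} → Adj n → Subset n → Set
Dominating {n} adj S = ∀ (v : Fin n) → v ∈ S ⊎ ∃ λ (w : Fin n) → w ∈ S × adj v w ≡ true

dominating? : {n : ℕ} (adj : Adj n) (S : Subset n) → Dec (Dominating adj S)
dominating? adj S = all? λ v → (v ∈? S) ⊎-dec any? (λ w → (w ∈? S) ×-dec (adj v w BoolP.≟ true))

allSubsets : (n : ℕ) → List (Subset n)
allSubsets zero = [] ∷ []
allSubsets (suc n) = map (true ∷_) (allSubsets n) ++ map (false ∷_) (allSubsets n)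

-- Polynomials with integer coefficients, as coefficient functions
-- (p i = coefficient of x^i); equality is pointwise equality of coefficients.

Poly : Set
Poly = ℕ → ℤ

_+ₚ_ : Poly → Poly → Poly
(p +ₚ q) i = p i ℤ.+ q i

_-ₚ_ : Poly → Poly → Poly
(p -ₚ q) i = p i ℤ.- q i

mulX+1 : Poly → Poly
mulX+1 p zero = p zero
mulX+1 p (suc i) = p (suc i) ℤ.+ p i

mulX+1^ : ℕ → Poly → Poly
mulX+1^ zero p = p
mulX+1^ (suc k) p = mulX+1 (mulX+1^ k p)

D : {n : ℕ} → Adj n → Poly
D {n} adj i = ℤ.+ length (filter (λ S → (dominating? adj S) ×-dec (∣ S ∣ ℕP.≟ i)) (allSubsets n))

delete : {m : ℕ} → Adj (suc m) → Fin (suc m) → Adj m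
delete adj u v w = adj (punchIn u v) (punchIn u w)

-- G_(u,k): glue G (vertices Fin n, embedded as the first n vertices) with
-- K_(k+1) whose vertices are u together with the k new vertices.
glue : {n : ℕ} → Adj n → Fin n → (k : ℕ) → Adj (n + k)
glue {n} adj u k v w with splitAt n v | splitAt n w
... | inj₁ a | inj₁ b = adj a b
... | inj₁ a | inj₂ _ = ⌊ a ≟ u ⌋
... | inj₂ _ | inj₁ b = ⌊ b ≟ u ⌋
... | inj₂ p | inj₂ q = not ⌊ p ≟ q ⌋

{-# OPTIONS --safe #-}
module Submission where

-- A subset of the vertices of G_(u,k) is a pair (T, R) with T ⊆ V(G) and R a set
-- of new clique vertices, and it dominates G_(u,k) iff T dominates every vertex of
-- G other than u and moreover u ∈ T or R ≠ ∅. The dominating sets of G ∖ u are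
-- exactly the sets T ∌ u dominating every vertex other than u. So for each such T
-- the sets R contribute (1 + x)^k · x^|T| when u ∈ T and ((1 + x)^k − 1) · x^|T|
-- when u ∉ T, and in the latter case G ∖ u supplies the missing x^|T|. Hence
-- D_{G_(u,k)} + D_{G∖u} = (1 + x)^k · A(x) with A independent of k, and the
-- claim follows by comparing k with 1.

open import Defs
open import Algebra.Bundles using (AbelianGroup)
open import Data.Bool as Bool using (Bool; true; false; not; _∧_; _∨_)
open import Data.Bool.Properties using (∧-zeroʳ; ∧-identityʳ)
open import Data.Empty using (⊥-elim)
open import Data.Fin using (Fin; zero; suc; splitAt; punchIn; punchOut; _↑ˡ_; _↑ʳ_; _≟_)
open import Data.Fin.Properties using (all?; any?; splitAt-↑ˡ; splitAt-↑ʳ; splitAt⁻¹-↑ˡ; splitAt⁻¹-↑ʳ; punchInᵢ≢i; punchIn-punchOut)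
open import Data.Fin.Subset using (Subset; _∈_; _∉_; ∣_∣; Nonempty)
open import Data.Fin.Subset.Properties using (_∈?_; nonempty?)
open import Data.Integer as ℤ using (ℤ; +_; 0ℤ; 1ℤ)
import Data.Integer.Properties as ℤP
open import Data.List using (List; []; _∷_; map; filter; length) renaming (_++_ to _++ᴸ_)
open import Data.List.Properties using (length-++; filter-++; filter-none; filter-≐)
open import Data.List.Relation.Unary.All using (universal)
open import Data.Nat using (ℕ; zero; suc; _+_)
import Data.Nat.Properties as ℕP
open import Data.Product using (∃; _×_; _,_)
open import Data.Sum using (_⊎_; inj₁; inj₂)
open import Data.Vec using (Vec; []; _∷_; _++_; _[_]=_; insertAt; here; there)
open import Data.Vec.Properties using ([]=⇒lookup; lookup⇒[]=; insertAt-lookup; insertAt-punchIn)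
open import Function using (_∘_; const)
open import Function.Bundles using (_⇔_; mk⇔; module Equivalence)
open import Relation.Binary.PropositionalEquality using (_≡_; _≢_; _≗_; subst; refl; sym; trans; cong; cong₂; _→-setoid_; module ≡-Reasoning)
open import Relation.Nullary using (Dec; yes; no; ¬?; does)
open import Relation.Nullary.Decidable using (isYes≗does; dec-true; dec-false; does-⇔; _×-dec_; _⊎-dec_; _→-dec_)
open import Relation.Unary using (_≐_)

import Algebra.Properties.CommutativeSemigroup as CommutativeSemigroupProperties
import Algebra.Properties.Group as GroupProperties
import Relation.Binary.Reasoning.Setoid as SetoidReasoning

module ≗-Reasoning = SetoidReasoning (ℕ →-setoid ℤ)

mulX : Poly → Poly
mulX p zero    = 0ℤ
mulX p (suc i) = p i

0ₚ : Poly
0ₚ = const 0ℤ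

1ₚ : Poly
1ₚ zero    = 1ℤ
1ₚ (suc _) = 0ℤ

[_] : Bool → Poly
[ true  ] = 1ₚ
[ false ] = 0ₚ

[]-cong : ∀ {a b} → a ≡ b → [ a ] ≗ [ b ]
[]-cong refl i = refl

+ₚ-cong : ∀ {p p′ q q′} → p ≗ p′ → q ≗ q′ → p +ₚ q ≗ p′ +ₚ q′
+ₚ-cong p≗p′ q≗q′ i = cong₂ ℤ._+_ (p≗p′ i) (q≗q′ i)

+ₚ-congˡ : ∀ p {q q′} → q ≗ q′ → p +ₚ q ≗ p +ₚ q′
+ₚ-congˡ p = +ₚ-cong {p} (λ _ → refl)

+ₚ-congʳ : ∀ q {p p′} → p ≗ p′ → p +ₚ q ≗ p′ +ₚ q
+ₚ-congʳ q p≗p′ = +ₚ-cong {q = q} p≗p′ (λ _ → refl)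

+ₚ-assoc : ∀ p q r → (p +ₚ q) +ₚ r ≗ p +ₚ (q +ₚ r)
+ₚ-assoc p q r i = ℤP.+-assoc (p i) (q i) (r i)

+ₚ-identityˡ : ∀ p → 0ₚ +ₚ p ≗ p
+ₚ-identityˡ p i = ℤP.+-identityˡ (p i)

+ₚ-identityʳ : ∀ p → p +ₚ 0ₚ ≗ p
+ₚ-identityʳ p i = ℤP.+-identityʳ (p i)

+ₚ-interchange : ∀ p q r s → (p +ₚ q) +ₚ (r +ₚ s) ≗ (p +ₚ r) +ₚ (q +ₚ s)
+ₚ-interchange p q r s i = interchange (p i) (q i) (r i) (s i)
  where open CommutativeSemigroupProperties ℤP.+-commutativeSemigroup

mulX-cong : ∀ {p q} → p ≗ q → mulX p ≗ mulX q
mulX-cong p≗q zero    = refl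
mulX-cong p≗q (suc i) = p≗q i

mulX-0ₚ : mulX 0ₚ ≗ 0ₚ
mulX-0ₚ zero    = refl
mulX-0ₚ (suc i) = refl

mulX-+ₚ : ∀ p q → mulX (p +ₚ q) ≗ mulX p +ₚ mulX q
mulX-+ₚ p q zero    = refl
mulX-+ₚ p q (suc i) = refl

mulX+1-cong : ∀ {p q} → p ≗ q → mulX+1 p ≗ mulX+1 q
mulX+1-cong p≗q zero    = p≗q zero
mulX+1-cong p≗q (suc i) = cong₂ ℤ._+_ (p≗q (suc i)) (p≗q i)

mulX+1^-cong : ∀ k {p q} → p ≗ q → mulX+1^ k p ≗ mulX+1^ k q
mulX+1^-cong zero    p≗q = p≗q
mulX+1^-cong (suc k) p≗q = mulX+1-cong (mulX+1^-cong k p≗q)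

mulX+1≗mulX+id : ∀ p → mulX+1 p ≗ mulX p +ₚ p
mulX+1≗mulX+id p zero    = sym (ℤP.+-identityˡ (p zero))
mulX+1≗mulX+id p (suc i) = ℤP.+-comm (p (suc i)) (p i)

mulX+1^-suc : ∀ k p → mulX+1^ (suc k) p ≗ mulX+1^ k (mulX+1 p)
mulX+1^-suc zero    p i = refl
mulX+1^-suc (suc k) p   = mulX+1-cong (mulX+1^-suc k p)

-- ∑ˢ n w is the sum of x ^ ∣ S ∣ * w S over all subsets S of Fin n.
∑ˢ : (n : ℕ) → (Subset n → Poly) → Poly
∑ˢ zero    w = w []
∑ˢ (suc n) w = mulX (∑ˢ n (w ∘ (true ∷_))) +ₚ ∑ˢ n (w ∘ (false ∷_))

∑ˢ-cong : ∀ n {v w : Subset n → Poly} → (∀ S → v S ≗ w S) → ∑ˢ n v ≗ ∑ˢ n w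
∑ˢ-cong zero    v≗w = v≗w []
∑ˢ-cong (suc n) v≗w =
  +ₚ-cong (mulX-cong (∑ˢ-cong n (v≗w ∘ (true ∷_)))) (∑ˢ-cong n (v≗w ∘ (false ∷_)))

∑ˢ-+ₚ : ∀ n (v w : Subset n → Poly) → ∑ˢ n (λ S → v S +ₚ w S) ≗ ∑ˢ n v +ₚ ∑ˢ n w
∑ˢ-+ₚ zero    v w i = refl
∑ˢ-+ₚ (suc n) v w   = begin
  mulX (∑ˢ n (λ S → v (true ∷ S) +ₚ w (true ∷ S))) +ₚ ∑ˢ n (λ S → v (false ∷ S) +ₚ w (false ∷ S))
    ≈⟨ +ₚ-cong (mulX-cong (∑ˢ-+ₚ n _ _)) (∑ˢ-+ₚ n _ _) ⟩
  mulX (∑ˢ n v₁ +ₚ ∑ˢ n w₁) +ₚ (∑ˢ n v₀ +ₚ ∑ˢ n w₀)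
    ≈⟨ +ₚ-congʳ (∑ˢ n v₀ +ₚ ∑ˢ n w₀) (mulX-+ₚ _ _) ⟩
  (mulX (∑ˢ n v₁) +ₚ mulX (∑ˢ n w₁)) +ₚ (∑ˢ n v₀ +ₚ ∑ˢ n w₀)
    ≈⟨ +ₚ-interchange (mulX (∑ˢ n v₁)) (mulX (∑ˢ n w₁)) (∑ˢ n v₀) (∑ˢ n w₀) ⟩
  (mulX (∑ˢ n v₁) +ₚ ∑ˢ n v₀) +ₚ (mulX (∑ˢ n w₁) +ₚ ∑ˢ n w₀) ∎
  where
  open ≗-Reasoning
  v₁ v₀ w₁ w₀ : Subset n → Poly
  v₁ = v ∘ (true ∷_)
  v₀ = v ∘ (false ∷_)
  w₁ = w ∘ (true ∷_)
  w₀ = w ∘ (false ∷_)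

∑ˢ-mulX : ∀ n (w : Subset n → Poly) → ∑ˢ n (mulX ∘ w) ≗ mulX (∑ˢ n w)
∑ˢ-mulX zero    w i = refl
∑ˢ-mulX (suc n) w   = begin
  mulX (∑ˢ n (mulX ∘ w ∘ (true ∷_))) +ₚ ∑ˢ n (mulX ∘ w ∘ (false ∷_))
    ≈⟨ +ₚ-cong (mulX-cong (∑ˢ-mulX n _)) (∑ˢ-mulX n _) ⟩
  mulX (mulX (∑ˢ n (w ∘ (true ∷_)))) +ₚ mulX (∑ˢ n (w ∘ (false ∷_)))
    ≈⟨ mulX-+ₚ _ _ ⟨
  mulX (∑ˢ (suc n) w) ∎
  where open ≗-Reasoning

∑ˢ-mulX+1 : ∀ n (w : Subset n → Poly) → ∑ˢ n (mulX+1 ∘ w) ≗ mulX+1 (∑ˢ n w)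
∑ˢ-mulX+1 n w = begin
  ∑ˢ n (mulX+1 ∘ w)                ≈⟨ ∑ˢ-cong n (mulX+1≗mulX+id ∘ w) ⟩
  ∑ˢ n (λ S → mulX (w S) +ₚ w S)   ≈⟨ ∑ˢ-+ₚ n _ _ ⟩
  ∑ˢ n (mulX ∘ w) +ₚ ∑ˢ n w        ≈⟨ +ₚ-congʳ (∑ˢ n w) (∑ˢ-mulX n w) ⟩
  mulX (∑ˢ n w) +ₚ ∑ˢ n w          ≈⟨ mulX+1≗mulX+id _ ⟨
  mulX+1 (∑ˢ n w)                  ∎
  where open ≗-Reasoning

∑ˢ-mulX+1^ : ∀ k n (w : Subset n → Poly) → ∑ˢ n (mulX+1^ k ∘ w) ≗ mulX+1^ k (∑ˢ n w)
∑ˢ-mulX+1^ zero    n w i = refl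
∑ˢ-mulX+1^ (suc k) n w i = trans (∑ˢ-mulX+1 n _ i) (mulX+1-cong (∑ˢ-mulX+1^ k n w) i)

∑ˢ-const : ∀ n p → ∑ˢ n (const p) ≗ mulX+1^ n p
∑ˢ-const zero    p i = refl
∑ˢ-const (suc n) p   = begin
  mulX (∑ˢ n (const p)) +ₚ ∑ˢ n (const p)  ≈⟨ +ₚ-cong (mulX-cong (∑ˢ-const n p)) (∑ˢ-const n p) ⟩
  mulX (mulX+1^ n p) +ₚ mulX+1^ n p        ≈⟨ mulX+1≗mulX+id _ ⟨
  mulX+1 (mulX+1^ n p)                     ∎
  where open ≗-Reasoning

∑ˢ-0ₚ : ∀ n → ∑ˢ n (const 0ₚ) ≗ 0ₚ
∑ˢ-0ₚ n i = trans (∑ˢ-const n 0ₚ i) (mulX+1^-0ₚ n i)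
  where
  mulX+1^-0ₚ : ∀ k → mulX+1^ k 0ₚ ≗ 0ₚ
  mulX+1^-0ₚ zero    i       = refl
  mulX+1^-0ₚ (suc k) zero    = mulX+1^-0ₚ k zero
  mulX+1^-0ₚ (suc k) (suc i) = cong₂ ℤ._+_ (mulX+1^-0ₚ k (suc i)) (mulX+1^-0ₚ k i)

∑ˢ-++ : ∀ n k (w : Subset (n + k) → Poly) → ∑ˢ (n + k) w ≗ ∑ˢ n (λ T → ∑ˢ k (λ R → w (T ++ R)))
∑ˢ-++ zero    k w i = refl
∑ˢ-++ (suc n) k w   = +ₚ-cong (mulX-cong (∑ˢ-++ n k _)) (∑ˢ-++ n k _)

∑ˢ-nonempty : ∀ n → ∑ˢ n (λ R → [ does (nonempty? R) ]) +ₚ 1ₚ ≗ ∑ˢ n (const 1ₚ)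
∑ˢ-nonempty zero    zero    = refl
∑ˢ-nonempty zero    (suc i) = refl
∑ˢ-nonempty (suc n)         = begin
  (mulX (∑ˢ n with-first) +ₚ ∑ˢ n without-first) +ₚ 1ₚ   ≈⟨ +ₚ-assoc (mulX (∑ˢ n with-first)) (∑ˢ n without-first) 1ₚ ⟩
  mulX (∑ˢ n with-first) +ₚ (∑ˢ n without-first +ₚ 1ₚ)
    ≈⟨ +ₚ-cong (mulX-cong (∑ˢ-cong n λ R → []-cong (dec-true (nonempty? (true ∷ R)) (zero , here))))
               (+ₚ-congʳ 1ₚ (∑ˢ-cong n λ R → []-cong (does-⇔ nonempty-false∷ (nonempty? (false ∷ R)) (nonempty? R)))) ⟩
  mulX (∑ˢ n (const 1ₚ)) +ₚ (∑ˢ n (λ R → [ does (nonempty? R) ]) +ₚ 1ₚ)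
    ≈⟨ +ₚ-congˡ (mulX (∑ˢ n (const 1ₚ))) (∑ˢ-nonempty n) ⟩
  mulX (∑ˢ n (const 1ₚ)) +ₚ ∑ˢ n (const 1ₚ)               ∎
  where
  open ≗-Reasoning
  with-first without-first : Subset n → Poly
  with-first    R = [ does (nonempty? (true ∷ R)) ]
  without-first R = [ does (nonempty? (false ∷ R)) ]
  nonempty-false∷ : ∀ {R : Subset n} → Nonempty (false ∷ R) ⇔ Nonempty R
  nonempty-false∷ = mk⇔ (λ { (suc x , there x∈R) → x , x∈R }) (λ (x , x∈R) → suc x , there x∈R)

∑ˢ-∉ : ∀ m (u : Fin (suc m)) (f : Subset (suc m) → Bool) →
       ∑ˢ (suc m) (λ T → [ f T ∧ not (does (u ∈? T)) ]) ≗ ∑ˢ m (λ R → [ f (insertAt R u false) ])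
∑ˢ-∉ m zero f = begin
  mulX (∑ˢ m (λ S → [ f (true ∷ S) ∧ false ])) +ₚ ∑ˢ m (λ S → [ f (false ∷ S) ∧ true ])
    ≈⟨ +ₚ-cong (mulX-cong (∑ˢ-cong m λ S → []-cong (∧-zeroʳ (f (true ∷ S)))))
               (∑ˢ-cong m λ S → []-cong (∧-identityʳ (f (false ∷ S)))) ⟩
  mulX (∑ˢ m (const 0ₚ)) +ₚ ∑ˢ m (λ S → [ f (false ∷ S) ])
    ≈⟨ +ₚ-congʳ (∑ˢ m (λ S → [ f (false ∷ S) ])) (λ i → trans (mulX-cong (∑ˢ-0ₚ m) i) (mulX-0ₚ i)) ⟩
  0ₚ +ₚ ∑ˢ m (λ S → [ f (false ∷ S) ])
    ≈⟨ +ₚ-identityˡ _ ⟩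
  ∑ˢ m (λ S → [ f (false ∷ S) ]) ∎
  where open ≗-Reasoning
∑ˢ-∉ zero    (suc ())
∑ˢ-∉ (suc m) (suc u) f =
  +ₚ-cong (mulX-cong (∑ˢ-∉ m u (f ∘ (true ∷_)))) (∑ˢ-∉ m u (f ∘ (false ∷_)))

length-filter-map : ∀ {A B : Set} {P : B → Set} (P? : ∀ b → Dec (P b)) (f : A → B) xs →
                    length (filter P? (map f xs)) ≡ length (filter (P? ∘ f) xs)
length-filter-map P? f []       = refl
length-filter-map P? f (x ∷ xs) with does (P? (f x))
... | true  = cong suc (length-filter-map P? f xs)
... | false = length-filter-map P? f xs

∑ˢ-counts : ∀ n {P : Subset n → Set} (P? : ∀ S → Dec (P S)) i →
            + length (filter (λ S → P? S ×-dec (∣ S ∣ ℕP.≟ i)) (allSubsets n)) ≡ ∑ˢ n (λ S → [ does (P? S) ]) i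
∑ˢ-counts zero P? i with does (P? [])
∑ˢ-counts zero P? zero    | true  = refl
∑ˢ-counts zero P? (suc i) | true  = refl
∑ˢ-counts zero P? i       | false = refl
∑ˢ-counts (suc n) {P} P? i = begin
  + length (filter (sized? i) (map (true ∷_) A ++ᴸ map (false ∷_) A))
    ≡⟨ cong (+_ ∘ length) (filter-++ (sized? i) (map (true ∷_) A) (map (false ∷_) A)) ⟩
  + length (filter (sized? i) (map (true ∷_) A) ++ᴸ filter (sized? i) (map (false ∷_) A))
    ≡⟨ cong +_ (length-++ (filter (sized? i) (map (true ∷_) A))) ⟩
  + length (filter (sized? i) (map (true ∷_) A)) ℤ.+ + length (filter (sized? i) (map (false ∷_) A))
    ≡⟨ cong₂ ℤ._+_ (first-in i) (trans (cong +_ (length-filter-map (sized? i) (false ∷_) A)) (∑ˢ-counts n (P? ∘ (false ∷_)) i)) ⟩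
  ∑ˢ (suc n) (λ S → [ does (P? S) ]) i ∎
  where
  open ≡-Reasoning
  A : List (Subset n)
  A = allSubsets n
  sized? : ∀ j (S : Subset (suc n)) → Dec (_ × ∣ S ∣ ≡ j)
  sized? j S = P? S ×-dec (∣ S ∣ ℕP.≟ j)
  first-in : ∀ j → + length (filter (sized? j) (map (true ∷_) A)) ≡ mulX (∑ˢ n (λ S → [ does (P? (true ∷ S)) ])) j
  first-in zero = cong +_ (trans (length-filter-map (sized? zero) (true ∷_) A)
                                  (cong length (filter-none (sized? zero ∘ (true ∷_)) (universal (λ { _ (_ , ()) }) A))))
  first-in (suc j) = trans (cong +_ (trans (length-filter-map (sized? (suc j)) (true ∷_) A)
                                            (cong length (filter-≐ _ _ size-suc A))))
                            (∑ˢ-counts n (P? ∘ (true ∷_)) j)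
    where
    size-suc : (λ S → P (true ∷ S) × suc ∣ S ∣ ≡ suc j) ≐ (λ S → P (true ∷ S) × ∣ S ∣ ≡ j)
    size-suc = (λ (p , e) → p , ℕP.suc-injective e) , (λ (p , e) → p , cong suc e)

D≗∑ˢ : ∀ {n} (adj : Adj n) → D adj ≗ ∑ˢ n (λ S → [ does (dominating? adj S) ])
D≗∑ˢ {n} adj = ∑ˢ-counts n (dominating? adj)

[]=-++⁺ˡ : ∀ {A : Set} {m n} {xs : Vec A m} {i x} (ys : Vec A n) → xs [ i ]= x → (xs ++ ys) [ i ↑ˡ n ]= x
[]=-++⁺ˡ ys here      = here
[]=-++⁺ˡ ys (there p) = there ([]=-++⁺ˡ ys p)

[]=-++⁻ˡ : ∀ {A : Set} {m n} {xs : Vec A m} {ys : Vec A n} {i x} → (xs ++ ys) [ i ↑ˡ n ]= x → xs [ i ]= x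
[]=-++⁻ˡ {xs = _ ∷ _} {i = zero}  here      = here
[]=-++⁻ˡ {xs = _ ∷ _} {i = suc i} (there p) = there ([]=-++⁻ˡ p)

[]=-++⁺ʳ : ∀ {A : Set} {m n} (xs : Vec A m) {ys : Vec A n} {j x} → ys [ j ]= x → (xs ++ ys) [ m ↑ʳ j ]= x
[]=-++⁺ʳ []       p = p
[]=-++⁺ʳ (_ ∷ xs) p = there ([]=-++⁺ʳ xs p)

[]=-++⁻ʳ : ∀ {A : Set} {m n} (xs : Vec A m) {ys : Vec A n} {j x} → (xs ++ ys) [ m ↑ʳ j ]= x → ys [ j ]= x
[]=-++⁻ʳ []       p         = p
[]=-++⁻ʳ (_ ∷ xs) (there p) = []=-++⁻ʳ xs p

[]=-insertAt-punchIn : ∀ {A : Set} {m} (xs : Vec A m) i y j {x} → insertAt xs i y [ punchIn i j ]= x ⇔ xs [ j ]= x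
[]=-insertAt-punchIn xs i y j = mk⇔
  (λ p → lookup⇒[]= j xs (trans (sym (insertAt-punchIn xs i y j)) ([]=⇒lookup p)))
  (λ p → lookup⇒[]= (punchIn i j) (insertAt xs i y) (trans (insertAt-punchIn xs i y j) ([]=⇒lookup p)))

∉-insertAt : ∀ {m} (R : Subset m) u → u ∉ insertAt R u false
∉-insertAt R u u∈ with () ← trans (sym ([]=⇒lookup u∈)) (insertAt-lookup R u false)

witness : ∀ {A : Set} (a? : Dec A) → does a? ≡ true → A
witness (yes a) _ = a

Dominated : ∀ {n} → Adj n → Subset n → Fin n → Set
Dominated {n} adj S v = v ∈ S ⊎ ∃ λ (w : Fin n) → w ∈ S × adj v w ≡ true

dominated? : ∀ {n} (adj : Adj n) S (v : Fin n) → Dec (Dominated adj S v)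
dominated? adj S v = (v ∈? S) ⊎-dec any? (λ w → (w ∈? S) ×-dec (adj v w Bool.≟ true))

DominatingExcept : ∀ {n} → Adj n → Fin n → Subset n → Set
DominatingExcept adj u S = ∀ v → v ≢ u → Dominated adj S v

dominatingExcept? : ∀ {n} (adj : Adj n) u (S : Subset n) → Dec (DominatingExcept adj u S)
dominatingExcept? adj u S = all? (λ v → ¬? (v ≟ u) →-dec dominated? adj S v)

module _ {m} (adj : Adj (suc m)) (u : Fin (suc m)) (R : Subset m) where

  private
    T : Subset (suc m)
    T = insertAt R u false

  dominated-delete : ∀ v → Dominated (delete adj u) R v ⇔ Dominated adj T (punchIn u v)
  dominated-delete v = mk⇔ to from
    where
    to : Dominated (delete adj u) R v → Dominated adj T (punchIn u v)
    to (inj₁ v∈R)            = inj₁ (Equivalence.from ([]=-insertAt-punchIn R u false v) v∈R)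
    to (inj₂ (w , w∈R , vw)) = inj₂ (punchIn u w , Equivalence.from ([]=-insertAt-punchIn R u false w) w∈R , vw)
    from : Dominated adj T (punchIn u v) → Dominated (delete adj u) R v
    from (inj₁ v∈T) = inj₁ (Equivalence.to ([]=-insertAt-punchIn R u false v) v∈T)
    from (inj₂ (w , w∈T , vw)) with u ≟ w
    ... | yes refl = ⊥-elim (∉-insertAt R u w∈T)
    ... | no u≢w rewrite sym (punchIn-punchOut u≢w) =
      inj₂ (punchOut u≢w , Equivalence.to ([]=-insertAt-punchIn R u false _) w∈T , vw)

  delete-dominating : Dominating (delete adj u) R ⇔ DominatingExcept adj u T
  delete-dominating = mk⇔
    (λ dom v v≢u → subst (Dominated adj T) (punchIn-punchOut (v≢u ∘ sym))
                         (Equivalence.to (dominated-delete _) (dom (punchOut (v≢u ∘ sym)))))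
    (λ dom v → Equivalence.from (dominated-delete v) (dom (punchIn u v) (punchInᵢ≢i u v)))

module _ {n} (adj : Adj n) (u : Fin n) where

  module _ (k : ℕ) where

    glue-old-old : ∀ a b → glue adj u k (a ↑ˡ k) (b ↑ˡ k) ≡ adj a b
    glue-old-old a b rewrite splitAt-↑ˡ n a k | splitAt-↑ˡ n b k = refl

    glue-old-new : ∀ a q → glue adj u k (a ↑ˡ k) (n ↑ʳ q) ≡ does (a ≟ u)
    glue-old-new a q rewrite splitAt-↑ˡ n a k | splitAt-↑ʳ n k q = isYes≗does (a ≟ u)

    glue-new-old : ∀ p b → glue adj u k (n ↑ʳ p) (b ↑ˡ k) ≡ does (b ≟ u)
    glue-new-old p b rewrite splitAt-↑ˡ n b k | splitAt-↑ʳ n k p = isYes≗does (b ≟ u)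

    glue-new-new : ∀ p q → glue adj u k (n ↑ʳ p) (n ↑ʳ q) ≡ not (does (p ≟ q))
    glue-new-new p q rewrite splitAt-↑ʳ n k p | splitAt-↑ʳ n k q = cong not (isYes≗does (p ≟ q))

    data Side : Fin (n + k) → Set where
      old : ∀ a → Side (a ↑ˡ k)
      new : ∀ q → Side (n ↑ʳ q)

    side : ∀ v → Side v
    side v with splitAt n v in eq
    ... | inj₁ a = subst Side (splitAt⁻¹-↑ˡ eq) (old a)
    ... | inj₂ q = subst Side (splitAt⁻¹-↑ʳ eq) (new q)

  module _ (k : ℕ) (T : Subset n) (R : Subset (suc k)) where

    private
      K = suc k
      G = glue adj u K

    dominated-old⁺ : ∀ {a} → Dominated adj T a → Dominated G (T ++ R) (a ↑ˡ K)
    dominated-old⁺ (inj₁ a∈T)            = inj₁ ([]=-++⁺ˡ R a∈T)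
    dominated-old⁺ (inj₂ (b , b∈T , ab)) = inj₂ (b ↑ˡ K , []=-++⁺ˡ R b∈T , trans (glue-old-old K _ b) ab)

    dominated-old⁻ : ∀ {a} → a ≢ u → Dominated G (T ++ R) (a ↑ˡ K) → Dominated adj T a
    dominated-old⁻ a≢u (inj₁ a∈S) = inj₁ ([]=-++⁻ˡ a∈S)
    dominated-old⁻ {a} a≢u (inj₂ (w , w∈S , aw)) with side K w
    ... | old b = inj₂ (b , []=-++⁻ˡ w∈S , trans (sym (glue-old-old K a b)) aw)
    ... | new q = ⊥-elim (a≢u (witness (a ≟ u) (trans (sym (glue-old-new K a q)) aw)))

    dominated-u : u ∈ T ⊎ Nonempty R → Dominated G (T ++ R) (u ↑ˡ K)
    dominated-u (inj₁ u∈T)       = inj₁ ([]=-++⁺ˡ R u∈T)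
    dominated-u (inj₂ (p , p∈R)) = inj₂ (n ↑ʳ p , []=-++⁺ʳ T p∈R , trans (glue-old-new K u p) (dec-true (u ≟ u) refl))

    dominated-new : ∀ q → Dominated G (T ++ R) (n ↑ʳ q) ⇔ (u ∈ T ⊎ Nonempty R)
    dominated-new q = mk⇔ to from
      where
      to : Dominated G (T ++ R) (n ↑ʳ q) → u ∈ T ⊎ Nonempty R
      to (inj₁ q∈S) = inj₂ (q , []=-++⁻ʳ T q∈S)
      to (inj₂ (w , w∈S , qw)) with side K w
      ... | old b = inj₁ (subst (_∈ T) (witness (b ≟ u) (trans (sym (glue-new-old K q b)) qw)) ([]=-++⁻ˡ w∈S))
      ... | new p = inj₂ (p , []=-++⁻ʳ T w∈S)
      from : u ∈ T ⊎ Nonempty R → Dominated G (T ++ R) (n ↑ʳ q)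
      from (inj₁ u∈T) = inj₂ (u ↑ˡ K , []=-++⁺ˡ R u∈T , trans (glue-new-old K q u) (dec-true (u ≟ u) refl))
      from (inj₂ (p , p∈R)) with p ≟ q
      ... | yes refl = inj₁ ([]=-++⁺ʳ T p∈R)
      ... | no p≢q   = inj₂ (n ↑ʳ p , []=-++⁺ʳ T p∈R , trans (glue-new-new K q p) (cong not (dec-false (q ≟ p) (p≢q ∘ sym))))

    -- This fails for an empty clique extension: only a new vertex forces u ∈ T or R ≠ ∅.
    glue-dominating : Dominating G (T ++ R) ⇔ (DominatingExcept adj u T × (u ∈ T ⊎ Nonempty R))
    glue-dominating = mk⇔
      (λ dom → (λ a a≢u → dominated-old⁻ a≢u (dom (a ↑ˡ K))) , Equivalence.to (dominated-new zero) (dom (n ↑ʳ zero)))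
      (λ (dex , covered) v → dominate dex covered v (side K v))
      where
      dominate : DominatingExcept adj u T → u ∈ T ⊎ Nonempty R → ∀ v → Side K v → Dominated G (T ++ R) v
      dominate dex covered _ (old a) with a ≟ u
      ... | yes refl = dominated-u covered
      ... | no a≢u   = dominated-old⁺ (dex a a≢u)
      dominate dex covered _ (new q) = Equivalence.from (dominated-new q) covered

glue+delete-weights : ∀ K a d →
  ∑ˢ K (λ R → [ a ∧ (d ∨ does (nonempty? R)) ]) +ₚ [ a ∧ not d ] ≗ mulX+1^ K [ a ]
glue+delete-weights K false d     i = trans (+ₚ-identityʳ (∑ˢ K (const 0ₚ)) i) (∑ˢ-const K 0ₚ i)
glue+delete-weights K true  true  i = trans (+ₚ-identityʳ (∑ˢ K (const 1ₚ)) i) (∑ˢ-const K 1ₚ i)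
glue+delete-weights K true  false i = trans (∑ˢ-nonempty K i) (∑ˢ-const K 1ₚ i)

module _ {m} (adj : Adj (suc m)) (u : Fin (suc m)) where

  private
    n = suc m

    A : Subset n → Bool
    A T = does (dominatingExcept? adj u T)

    glueWeight : ℕ → Subset n → Poly
    glueWeight k T = ∑ˢ (suc k) (λ R → [ A T ∧ (does (u ∈? T) ∨ does (nonempty? R)) ])

    deleteWeight : Subset n → Poly
    deleteWeight T = [ A T ∧ not (does (u ∈? T)) ]

  glue-dominating≡ : ∀ k T R → does (dominating? (glue adj u (suc k)) (T ++ R)) ≡ A T ∧ (does (u ∈? T) ∨ does (nonempty? R))
  glue-dominating≡ k T R = does-⇔ (glue-dominating adj u k T R) (dominating? _ _)
                                  (dominatingExcept? adj u T ×-dec (u ∈? T ⊎-dec nonempty? R))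

  delete-dominating≡ : ∀ R → does (dominating? (delete adj u) R) ≡ A (insertAt R u false)
  delete-dominating≡ R = does-⇔ (delete-dominating adj u R) (dominating? _ _) (dominatingExcept? adj u _)

  D-glue≗ : ∀ k → D (glue adj u (suc k)) ≗ ∑ˢ n (glueWeight k)
  D-glue≗ k = begin
    D G                                                            ≈⟨ D≗∑ˢ G ⟩
    ∑ˢ (n + suc k) (λ S → [ does (dominating? G S) ])              ≈⟨ ∑ˢ-++ n (suc k) (λ S → [ does (dominating? G S) ]) ⟩
    ∑ˢ n (λ T → ∑ˢ (suc k) (λ R → [ does (dominating? G (T ++ R)) ]))
      ≈⟨ ∑ˢ-cong n (λ T → ∑ˢ-cong (suc k) (λ R → []-cong (glue-dominating≡ k T R))) ⟩
    ∑ˢ n (glueWeight k)                                            ∎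
    where
    open ≗-Reasoning
    G = glue adj u (suc k)

  D-delete≗ : D (delete adj u) ≗ ∑ˢ n deleteWeight
  D-delete≗ = begin
    D (delete adj u)                                          ≈⟨ D≗∑ˢ (delete adj u) ⟩
    ∑ˢ m (λ R → [ does (dominating? (delete adj u) R) ])      ≈⟨ ∑ˢ-cong m ([]-cong ∘ delete-dominating≡) ⟩
    ∑ˢ m (λ R → [ A (insertAt R u false) ])                   ≈⟨ ∑ˢ-∉ m u A ⟨
    ∑ˢ n deleteWeight                                         ∎
    where open ≗-Reasoning

  D-glue+D-delete : ∀ k → D (glue adj u (suc k)) +ₚ D (delete adj u) ≗ mulX+1^ (suc k) (∑ˢ n (λ T → [ A T ]))
  D-glue+D-delete k = begin
    D (glue adj u (suc k)) +ₚ D (delete adj u)           ≈⟨ +ₚ-cong (D-glue≗ k) D-delete≗ ⟩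
    ∑ˢ n (glueWeight k) +ₚ ∑ˢ n deleteWeight             ≈⟨ ∑ˢ-+ₚ n (glueWeight k) deleteWeight ⟨
    ∑ˢ n (λ T → glueWeight k T +ₚ deleteWeight T)        ≈⟨ ∑ˢ-cong n (λ T → glue+delete-weights (suc k) (A T) (does (u ∈? T))) ⟩
    ∑ˢ n (λ T → mulX+1^ (suc k) [ A T ])                 ≈⟨ ∑ˢ-mulX+1^ (suc k) n (λ T → [ A T ]) ⟩
    mulX+1^ (suc k) (∑ˢ n (λ T → [ A T ]))               ∎
    where open ≗-Reasoning

  D-glue+D-delete-recurrence : ∀ k → D (glue adj u (suc k)) +ₚ D (delete adj u) ≗ mulX+1^ k (D (glue adj u 1) +ₚ D (delete adj u))
  D-glue+D-delete-recurrence k = begin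
    D (glue adj u (suc k)) +ₚ D (delete adj u)          ≈⟨ D-glue+D-delete k ⟩
    mulX+1^ (suc k) (∑ˢ n (λ T → [ A T ]))              ≈⟨ mulX+1^-suc k _ ⟩
    mulX+1^ k (mulX+1 (∑ˢ n (λ T → [ A T ])))           ≈⟨ mulX+1^-cong k (D-glue+D-delete 0) ⟨
    mulX+1^ k (D (glue adj u 1) +ₚ D (delete adj u))    ∎
    where open ≗-Reasoning

lemma3p2 : (m : ℕ) (adj : Adj (suc m)) → IsSimple adj → (u : Fin (suc m)) → (k : ℕ) → (i : ℕ)
    → D (glue adj u (suc k)) i
      ≡ (mulX+1^ k (D (glue adj u 1) +ₚ D (delete adj u)) -ₚ D (delete adj u)) i
lemma3p2 m adj _ u k i = begin
  D (glue adj u (suc k)) i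
    ≡⟨ //-rightDividesʳ (D (delete adj u) i) (D (glue adj u (suc k)) i) ⟨
  (D (glue adj u (suc k)) +ₚ D (delete adj u)) i ℤ.- D (delete adj u) i
    ≡⟨ cong (ℤ._- D (delete adj u) i) (D-glue+D-delete-recurrence adj u k i) ⟩
  (mulX+1^ k (D (glue adj u 1) +ₚ D (delete adj u)) -ₚ D (delete adj u)) i ∎
  where
  open ≡-Reasoning
  open GroupProperties (AbelianGroup.group ℤP.+-0-abelianGroup)
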